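{- For each integer $r \ge 2$, the matrix $A_r$ is $2$-modular.
   Context: An integer matrix $A$ is $2$-modular if the determinant of every $\operatorname{rank}(A) \times \operatorname{rank}(A)$ submatrix has absolute value at most $2$. $D_r$ denotes the $r \times \binom{r}{2}$ matrix whose columns are all $r$-tuples with exactly two nonzero entries, the first (in position order) equal to $1$ and the second equal to $-1$. $A_r$ is the $r$-row matrix $[\,I_r \mid D_r \mid B\,]$ where $B$ is the $r \times (r-1)$ matrix whose first row is all ones and whose remaining $r-1$ rows form $I_{r-1}$. -}

module Defs where

open import Data.Nat using (ℕ; zero; suc)
open import Data.Integer using (ℤ; _+_; _*_; -_; ∣_∣; 0ℤ; 1ℤ)
open import Data.Fin using (Fin; zero; suc; toℕ; punchIn; _<_; _≟_)
open import Data.List using (List; length; lookup; map; concatMap; filter; allFin; _++_)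
open import Data.Product using (Σ; _×_; _,_)
open import Data.Bool using (if_then_else_)
open import Relation.Nullary using (does; ¬_)
open import Relation.Binary.PropositionalEquality using (_≡_)
import Data.Nat as ℕ

Matrix : ℕ → ℕ → Set
Matrix m n = Fin m → Fin n → ℤ

sumFin : ∀ {n} → (Fin n → ℤ) → ℤ
sumFin {zero}  f = 0ℤ
sumFin {suc n} f = f zero + sumFin (λ i → f (suc i))

alt : ℕ → ℤ → ℤ
alt zero    x = x
alt (suc k) x = - alt k x

det : ∀ {n} → Matrix n n → ℤ
det {zero}  M = 1ℤ
det {suc n} M = sumFin λ j → alt (toℕ j) (M zero j * det (λ a b → M (suc a) (punchIn j b)))

Increasing : ∀ {k n} → (Fin k → Fin n) → Set
Increasing f = ∀ a b → a < b → f a < f b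

submatrix : ∀ {m n k} → Matrix m n → (Fin k → Fin m) → (Fin k → Fin n) → Matrix k k
submatrix M rs cs a b = M (rs a) (cs b)

IsRank : ∀ {m n} → Matrix m n → ℕ → Set
IsRank {m} {n} M k =
  (Σ (Fin k → Fin m) λ rs → Σ (Fin k → Fin n) λ cs →
     Increasing rs × Increasing cs × ¬ (det (submatrix M rs cs) ≡ 0ℤ))
  × (∀ (rs : Fin (suc k) → Fin m) (cs : Fin (suc k) → Fin n) →
       Increasing rs → Increasing cs → det (submatrix M rs cs) ≡ 0ℤ)

IsModular : ℕ → ∀ {m n} → Matrix m n → Set
IsModular Δ {m} {n} M = ∀ k → IsRank M k →
  ∀ (rs : Fin k → Fin m) (cs : Fin k → Fin n) → Increasing rs → Increasing cs →
  ∣ det (submatrix M rs cs) ∣ ℕ.≤ Δ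

fromCols : ∀ {m} (cs : List (Fin m → ℤ)) → Matrix m (length cs)
fromCols cs i j = lookup cs j i

unit : ∀ {r} → Fin r → Fin r → ℤ
unit k i = if does (i ≟ k) then 1ℤ else 0ℤ

colsI : ∀ r → List (Fin r → ℤ)
colsI r = map unit (allFin r)

-- columns of D_r: e_i - e_j for i < j, in lexicographic order of (i, j)
colsD : ∀ r → List (Fin r → ℤ)
colsD r = concatMap (λ i → map (λ j x → unit i x + - unit j x)
                               (filter (λ j → toℕ i ℕ.<? toℕ j) (allFin r)))
                    (allFin r)

-- columns of B: first row all ones, remaining rows I_{r-1};
-- i.e. the columns e_0 + e_j for j = 1, …, r-1
colsB : ∀ r → List (Fin r → ℤ)
colsB r = map (λ j x → (if does (toℕ x ℕ.≟ 0) then 1ℤ else 0ℤ) + unit j x)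
              (filter (λ j → 1 ℕ.≤? toℕ j) (allFin r))

colsA : ∀ r → List (Fin r → ℤ)
colsA r = colsI r ++ (colsD r ++ colsB r)

A : ∀ r → Matrix r (length (colsA r))
A r = fromCols (colsA r)

D : ∀ r → Matrix r (length (colsD r))
D r = fromCols (colsD r)

module Submission where

-- The columns of I_r and D_r are columns e_h − e_t of incidence matrices of directed graphs
-- (network columns), and the columns e₀ + e_j of B become network columns once their first
-- entry is negated; both properties survive restriction to increasing rows. A square matrix
-- with network columns has determinant 0 or ±1: column operations clear its first row outside
-- a ±1 pivot and leave network columns in the complementary minor. For a square submatrix of
-- A_r, splitting the first row into the entries coming from network columns and the rest
-- writes its determinant as det P − det Q with P and Q network matrices, so it is at most 2
-- in absolute value.

open import Defs
import Algebra.Properties.Semiring.Sum as SemiringSum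
open import Data.Bool using (if_then_else_)
open import Data.Fin using (Fin; zero; suc; toℕ; punchIn; punchOut; inject₁; _≟_)
import Data.Fin as F
import Data.Fin.Properties as FP
open import Data.Integer using (ℤ; _+_; _*_; -_; _-_; ∣_∣; 0ℤ; 1ℤ; -1ℤ)
import Data.Integer as ℤ
import Data.Integer.Properties as ℤP
open import Data.Integer.Tactic.RingSolver using (solve-∀)
open import Data.List using ([]; _∷_; allFin; length)
open import Data.List.Membership.Propositional using (_∉_)
open import Data.List.Membership.Propositional.Properties using (∈-allFin; ∈-lookup)
open import Data.List.Relation.Unary.All using (All)
import Data.List.Relation.Unary.All as All
open import Data.List.Relation.Unary.All.Properties using (++⁺; map⁺; concat⁺; filter⁺; all-filter)
open import Data.List.Relation.Unary.Any using (here; there)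
open import Data.Maybe using (Maybe; just; nothing)
open import Data.Nat using (ℕ; zero; suc; _≤_; z≤n; s≤s)
import Data.Nat as ℕ
import Data.Nat.Properties as ℕP
open import Data.Product using (Σ-syntax; _×_; _,_)
open import Data.Sum using (_⊎_; inj₁; inj₂)
open import Data.Vec.Functional using (updateAt)
open import Data.Vec.Functional.Properties using (updateAt-updates; updateAt-minimal; updateAt-id-local)
open import Function using (_∘_; const)
open import Function.Definitions using (Injective)
open import Relation.Binary.Definitions using (tri<; tri≈; tri>)
open import Relation.Binary.PropositionalEquality
open import Relation.Nullary using (yes; no; does; contradiction; ¬?)
open import Relation.Nullary.Decidable using (decidable-stable)

open SemiringSum ℤP.+-*-semiring using (sum; sum-cong-≗; ∑-distrib-+; *-distribˡ-sum; sum-remove)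
open ≡-Reasoning

-- Finite sums

sumFin≡sum : ∀ {n} (f : Fin n → ℤ) → sumFin f ≡ sum f
sumFin≡sum {zero}  f = refl
sumFin≡sum {suc n} f = cong (f zero +_) (sumFin≡sum (f ∘ suc))

sum-zero : ∀ {n} {f : Fin n → ℤ} → (∀ j → f j ≡ 0ℤ) → sum f ≡ 0ℤ
sum-zero {zero}  _ = refl
sum-zero {suc n} f≡0 = cong₂ _+_ (f≡0 zero) (sum-zero (f≡0 ∘ suc))

sum-single : ∀ {n} {f : Fin (suc n) → ℤ} c → (∀ j → j ≢ c → f j ≡ 0ℤ) → sum f ≡ f c
sum-single {f = f} c f≡0 = begin
  sum f                                   ≡⟨ sum-remove f ⟩
  f c + sum (λ b → f (punchIn c b))       ≡⟨ cong (f c +_) (sum-zero (λ b → f≡0 _ (FP.punchInᵢ≢i c b))) ⟩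
  f c + 0ℤ                                ≡⟨ ℤP.+-identityʳ (f c) ⟩
  f c                                     ∎

sum-pair : ∀ {n} {f : Fin n → ℤ} p q → p ≢ q → (∀ j → j ≢ p → j ≢ q → f j ≡ 0ℤ) →
           sum f ≡ f p + f q
sum-pair zero    zero    p≢q _   = contradiction refl p≢q
sum-pair {suc (suc n)} {f} zero (suc q) _ f≡0 =
  cong (f zero +_) (sum-single q λ j j≢q → f≡0 (suc j) (λ ()) (j≢q ∘ FP.suc-injective))
sum-pair {suc (suc n)} {f} (suc p) zero _ f≡0 = begin
  f zero + sum (f ∘ suc)
    ≡⟨ cong (f zero +_) (sum-single p λ j j≢p → f≡0 (suc j) (j≢p ∘ FP.suc-injective) (λ ())) ⟩
  f zero + f (suc p)     ≡⟨ ℤP.+-comm (f zero) (f (suc p)) ⟩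
  f (suc p) + f zero     ∎
sum-pair {f = f} (suc p) (suc q) p≢q f≡0 = begin
  f zero + sum (f ∘ suc) ≡⟨ cong (_+ sum (f ∘ suc)) (f≡0 zero (λ ()) (λ ())) ⟩
  0ℤ + sum (f ∘ suc)     ≡⟨ ℤP.+-identityˡ _ ⟩
  sum (f ∘ suc)          ≡⟨ sum-pair p q (p≢q ∘ cong suc) (λ j j≢p j≢q →
                              f≡0 (suc j) (j≢p ∘ FP.suc-injective) (j≢q ∘ FP.suc-injective)) ⟩
  f (suc p) + f (suc q)  ∎

-- Determinants

alt-+ : ∀ k x y → alt k (x + y) ≡ alt k x + alt k y
alt-+ zero    x y = refl
alt-+ (suc k) x y = trans (cong -_ (alt-+ k x y)) (ℤP.neg-distrib-+ (alt k x) (alt k y))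

alt-* : ∀ k x y → alt k (x * y) ≡ x * alt k y
alt-* zero    x y = refl
alt-* (suc k) x y = trans (cong -_ (alt-* k x y)) (ℤP.neg-distribʳ-* x _)

alt-0 : ∀ k → alt k 0ℤ ≡ 0ℤ
alt-0 zero    = refl
alt-0 (suc k) = cong -_ (alt-0 k)

∣alt∣ : ∀ k x → ∣ alt k x ∣ ≡ ∣ x ∣
∣alt∣ zero    x = refl
∣alt∣ (suc k) x = trans (ℤP.∣-i∣≡∣i∣ (alt k x)) (∣alt∣ k x)

minor : ∀ {n} → Matrix (suc n) (suc n) → Fin (suc n) → Matrix n n
minor M j a b = M (suc a) (punchIn j b)

laplaceTerm : ∀ {n} → Matrix (suc n) (suc n) → Fin (suc n) → ℤ
laplaceTerm M j = alt (toℕ j) (M zero j * det (minor M j))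

det-laplace : ∀ {n} (M : Matrix (suc n) (suc n)) → det M ≡ sum (laplaceTerm M)
det-laplace M = sumFin≡sum (laplaceTerm M)

det-cong : ∀ {n} {M N : Matrix n n} → (∀ a b → M a b ≡ N a b) → det M ≡ det N
det-cong {zero}          _    = refl
det-cong {suc n} {M} {N} M≗N = begin
  det M               ≡⟨ det-laplace M ⟩
  sum (laplaceTerm M) ≡⟨ sum-cong-≗ term ⟩
  sum (laplaceTerm N) ≡⟨ det-laplace N ⟨
  det N               ∎
  where
  term : ∀ j → laplaceTerm M j ≡ laplaceTerm N j
  term j = cong (alt (toℕ j)) (cong₂ _*_ (M≗N zero j) (det-cong λ a b → M≗N (suc a) (punchIn j b)))

AgreeOutside : ∀ {n} → Fin n → Matrix n n → Matrix n n → Set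
AgreeOutside c M N = ∀ a b → b ≢ c → M a b ≡ N a b

minor-punchOut : ∀ {n} (M : Matrix (suc n) (suc n)) {j c} (j≢c : j ≢ c) a →
                 minor M j a (punchOut j≢c) ≡ M (suc a) c
minor-punchOut M j≢c a = cong (M (suc a)) (FP.punchIn-punchOut j≢c)

module _ {n} {M N : Matrix (suc n) (suc n)} {c} (M~N : AgreeOutside c M N) where

  minor-agreeAt : ∀ a b → minor M c a b ≡ minor N c a b
  minor-agreeAt a b = M~N (suc a) (punchIn c b) (FP.punchInᵢ≢i c b)

  minor-agreeOutside : ∀ {j} (j≢c : j ≢ c) → AgreeOutside (punchOut j≢c) (minor M j) (minor N j)
  minor-agreeOutside {j} j≢c a b b≢ = M~N (suc a) (punchIn j b) λ e →
    b≢ (FP.punchIn-injective j b _ (trans e (sym (FP.punchIn-punchOut j≢c))))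

det-column-+ : ∀ {n} {M N P : Matrix n n} c → AgreeOutside c M P → AgreeOutside c N P →
               (∀ a → P a c ≡ M a c + N a c) → det P ≡ det M + det N
det-column-+ {suc n} {M} {N} {P} c M~P N~P Pc = begin
  det P                                         ≡⟨ det-laplace P ⟩
  sum (laplaceTerm P)                           ≡⟨ sum-cong-≗ term ⟩
  sum (λ j → laplaceTerm M j + laplaceTerm N j) ≡⟨ ∑-distrib-+ (laplaceTerm M) (laplaceTerm N) ⟩
  sum (laplaceTerm M) + sum (laplaceTerm N)     ≡⟨ cong₂ _+_ (det-laplace M) (det-laplace N) ⟨
  det M + det N                                 ∎
  where
  term : ∀ j → laplaceTerm P j ≡ laplaceTerm M j + laplaceTerm N j
  term j with j ≟ c
  ... | yes refl = begin
    alt k (P zero j * det (minor P j))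
      ≡⟨ cong (λ x → alt k (x * det (minor P j))) (Pc zero) ⟩
    alt k ((M zero j + N zero j) * det (minor P j))
      ≡⟨ cong (alt k) (ℤP.*-distribʳ-+ _ (M zero j) (N zero j)) ⟩
    alt k (M zero j * det (minor P j) + N zero j * det (minor P j)) ≡⟨ alt-+ k _ _ ⟩
    alt k (M zero j * det (minor P j)) + alt k (N zero j * det (minor P j))
      ≡⟨ cong₂ (λ d e → alt k (M zero j * d) + alt k (N zero j * e))
               (det-cong (minor-agreeAt M~P)) (det-cong (minor-agreeAt N~P)) ⟨
    laplaceTerm M j + laplaceTerm N j                              ∎
    where k = toℕ j
  ... | no j≢c = begin
    alt k (P zero j * det (minor P j))
      ≡⟨ cong (λ d → alt k (P zero j * d)) minor-+ ⟩
    alt k (P zero j * (det (minor M j) + det (minor N j)))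
      ≡⟨ cong (alt k) (ℤP.*-distribˡ-+ (P zero j) _ _) ⟩
    alt k (P zero j * det (minor M j) + P zero j * det (minor N j))        ≡⟨ alt-+ k _ _ ⟩
    alt k (P zero j * det (minor M j)) + alt k (P zero j * det (minor N j))
      ≡⟨ cong₂ (λ x y → alt k (x * det (minor M j)) + alt k (y * det (minor N j)))
               (M~P zero j j≢c) (N~P zero j j≢c) ⟨
    laplaceTerm M j + laplaceTerm N j                                      ∎
    where
    k = toℕ j
    minor-+ : det (minor P j) ≡ det (minor M j) + det (minor N j)
    minor-+ = det-column-+ (punchOut j≢c) (minor-agreeOutside M~P j≢c) (minor-agreeOutside N~P j≢c) λ a →
      trans (minor-punchOut P j≢c a)
            (trans (Pc (suc a)) (sym (cong₂ _+_ (minor-punchOut M j≢c a) (minor-punchOut N j≢c a))))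

det-column-* : ∀ {n} {M P : Matrix n n} c x → AgreeOutside c M P →
               (∀ a → P a c ≡ x * M a c) → det P ≡ x * det M
det-column-* {suc n} {M} {P} c x M~P Pc = begin
  det P                             ≡⟨ det-laplace P ⟩
  sum (laplaceTerm P)               ≡⟨ sum-cong-≗ term ⟩
  sum (λ j → x * laplaceTerm M j)   ≡⟨ *-distribˡ-sum x (laplaceTerm M) ⟨
  x * sum (laplaceTerm M)           ≡⟨ cong (x *_) (det-laplace M) ⟨
  x * det M                         ∎
  where
  term : ∀ j → laplaceTerm P j ≡ x * laplaceTerm M j
  term j with j ≟ c
  ... | yes refl = begin
    alt k (P zero j * det (minor P j))
      ≡⟨ cong₂ (λ y d → alt k (y * d)) (Pc zero) (sym (det-cong (minor-agreeAt M~P))) ⟩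
    alt k (x * M zero j * det (minor M j)) ≡⟨ cong (alt k) (ℤP.*-assoc x _ _) ⟩
    alt k (x * (M zero j * det (minor M j))) ≡⟨ alt-* k x _ ⟩
    x * laplaceTerm M j                  ∎
    where k = toℕ j
  ... | no j≢c = begin
    alt k (P zero j * det (minor P j))     ≡⟨ cong₂ (λ y d → alt k (y * d)) (sym (M~P zero j j≢c)) minor-* ⟩
    alt k (M zero j * (x * det (minor M j))) ≡⟨ cong (alt k) (swap-* (M zero j) x _) ⟩
    alt k (x * (M zero j * det (minor M j))) ≡⟨ alt-* k x _ ⟩
    x * laplaceTerm M j                    ∎
    where
    k = toℕ j
    swap-* : ∀ u v w → u * (v * w) ≡ v * (u * w)
    swap-* = solve-∀
    minor-* : det (minor P j) ≡ x * det (minor M j)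
    minor-* = det-column-* (punchOut j≢c) x (minor-agreeOutside M~P j≢c) λ a →
      trans (minor-punchOut P j≢c a) (trans (Pc (suc a)) (cong (x *_) (sym (minor-punchOut M j≢c a))))

column : ∀ {m n} → Matrix m n → Fin n → Fin m → ℤ
column M j a = M a j

replaceColumn : ∀ {n} → Matrix n n → Fin n → (Fin n → ℤ) → Matrix n n
replaceColumn M j v a = updateAt (M a) j (const (v a))

module _ {n} (M : Matrix n n) (j : Fin n) where

  replaceColumn-at : ∀ v a → replaceColumn M j v a j ≡ v a
  replaceColumn-at v a = updateAt-updates j (M a)

  replaceColumn-off : ∀ v a {b} → b ≢ j → replaceColumn M j v a b ≡ M a b
  replaceColumn-off v a {b} b≢j = updateAt-minimal b j (M a) b≢j

  replaceColumn-agree : ∀ v w → AgreeOutside j (replaceColumn M j v) (replaceColumn M j w)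
  replaceColumn-agree v w a b b≢j = trans (replaceColumn-off v a b≢j) (sym (replaceColumn-off w a b≢j))

  det-replaceColumn-self : det (replaceColumn M j (column M j)) ≡ det M
  det-replaceColumn-self = det-cong λ a → updateAt-id-local j (M a) refl

det-replaceColumn-+ : ∀ {n} (M : Matrix n n) j (u v : Fin n → ℤ) →
  det (replaceColumn M j (λ a → u a + v a)) ≡ det (replaceColumn M j u) + det (replaceColumn M j v)
det-replaceColumn-+ M j u v = det-column-+ j (replaceColumn-agree M j u u+v) (replaceColumn-agree M j v u+v) λ a →
  trans (replaceColumn-at M j u+v a) (sym (cong₂ _+_ (replaceColumn-at M j u a) (replaceColumn-at M j v a)))
  where
  u+v : Fin _ → ℤ
  u+v a = u a + v a

det-replaceColumn-* : ∀ {n} (M : Matrix n n) j x (v : Fin n → ℤ) →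
  det (replaceColumn M j (λ a → x * v a)) ≡ x * det (replaceColumn M j v)
det-replaceColumn-* M j x v = det-column-* j x (replaceColumn-agree M j v xv) λ a →
  trans (replaceColumn-at M j xv a) (cong (x *_) (sym (replaceColumn-at M j v a)))
  where
  xv : Fin _ → ℤ
  xv a = x * v a

replaceColumn-preservesAgree : ∀ {n} {M N : Matrix n n} {c j} v →
  AgreeOutside c M N → AgreeOutside c (replaceColumn M j v) (replaceColumn N j v)
replaceColumn-preservesAgree {M = M} {N} {j = j} v M~N a b b≢c with b ≟ j
... | yes refl = trans (replaceColumn-at M j v a) (sym (replaceColumn-at N j v a))
... | no b≢j   = trans (replaceColumn-off M j v a b≢j) (trans (M~N a b b≢c) (sym (replaceColumn-off N j v a b≢j)))

data Adjacent : ∀ {n} → Fin n → Fin n → Set where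
  adj-zero : ∀ {n} → Adjacent {suc (suc n)} zero (suc zero)
  adj-suc  : ∀ {n} {p q : Fin n} → Adjacent p q → Adjacent (suc p) (suc q)

adjacent⇒≢ : ∀ {n} {p q : Fin n} → Adjacent p q → p ≢ q
adjacent⇒≢ adj-zero    ()
adjacent⇒≢ (adj-suc a) e = adjacent⇒≢ a (FP.suc-injective e)

toℕ-adjacent : ∀ {n} {p q : Fin n} → Adjacent p q → toℕ q ≡ suc (toℕ p)
toℕ-adjacent adj-zero    = refl
toℕ-adjacent (adj-suc a) = cong suc (toℕ-adjacent a)

inject₁-adjacent : ∀ {n} (q : Fin n) → Adjacent (inject₁ q) (suc q)
inject₁-adjacent zero    = adj-zero
inject₁-adjacent (suc q) = adj-suc (inject₁-adjacent q)

punchOut-adjacent : ∀ {n} {p q : Fin (suc n)} → Adjacent p q → ∀ {j} (j≢p : j ≢ p) (j≢q : j ≢ q) →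
                    Adjacent (punchOut j≢p) (punchOut j≢q)
punchOut-adjacent adj-zero {zero}        j≢p _   = contradiction refl j≢p
punchOut-adjacent adj-zero {suc zero}    _   j≢q = contradiction refl j≢q
punchOut-adjacent {suc (suc n)} adj-zero {suc (suc j)} _ _ = adj-zero
punchOut-adjacent (adj-suc a) {zero}     _   _   = a
punchOut-adjacent {suc n} (adj-suc a) {suc j} j≢p j≢q =
  adj-suc (punchOut-adjacent a (j≢p ∘ cong suc) (j≢q ∘ cong suc))

punchIn-adjacent : ∀ {n} {p q : Fin (suc n)} → Adjacent p q → ∀ b →
                   punchIn p b ≡ punchIn q b ⊎ (punchIn p b ≡ q × punchIn q b ≡ p)
punchIn-adjacent adj-zero    zero    = inj₂ (refl , refl)
punchIn-adjacent adj-zero    (suc b) = inj₁ refl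
punchIn-adjacent (adj-suc a) zero    = inj₁ refl
punchIn-adjacent (adj-suc a) (suc b) with punchIn-adjacent a b
... | inj₁ e         = inj₁ (cong suc e)
... | inj₂ (e₁ , e₂) = inj₂ (cong suc e₁ , cong suc e₂)

-- Equal adjacent columns give equal minors at p and q, whose Laplace terms differ only in sign.
det-adjacentColumns : ∀ {n} {M : Matrix n n} {p q} → Adjacent p q → (∀ a → M a p ≡ M a q) → det M ≡ 0ℤ
det-adjacentColumns {suc n} {M} {p} {q} p~q Mp≡Mq = begin
  det M                                     ≡⟨ det-laplace M ⟩
  sum (laplaceTerm M)                       ≡⟨ sum-pair p q (adjacent⇒≢ p~q) others ⟩
  laplaceTerm M p + laplaceTerm M q         ≡⟨ cong (laplaceTerm M p +_) termq ⟩
  laplaceTerm M p + - laplaceTerm M p       ≡⟨ ℤP.+-inverseʳ (laplaceTerm M p) ⟩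
  0ℤ                                        ∎
  where
  others : ∀ j → j ≢ p → j ≢ q → laplaceTerm M j ≡ 0ℤ
  others j j≢p j≢q = begin
    alt (toℕ j) (M zero j * det (minor M j)) ≡⟨ cong (λ d → alt (toℕ j) (M zero j * d)) minor≡0 ⟩
    alt (toℕ j) (M zero j * 0ℤ)             ≡⟨ cong (alt (toℕ j)) (ℤP.*-zeroʳ (M zero j)) ⟩
    alt (toℕ j) 0ℤ                          ≡⟨ alt-0 (toℕ j) ⟩
    0ℤ                                      ∎
    where
    minor≡0 : det (minor M j) ≡ 0ℤ
    minor≡0 = det-adjacentColumns (punchOut-adjacent p~q j≢p j≢q) λ a →
      trans (minor-punchOut M j≢p a) (trans (Mp≡Mq (suc a)) (sym (minor-punchOut M j≢q a)))
  minors : ∀ a b → minor M q a b ≡ minor M p a b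
  minors a b with punchIn-adjacent p~q b
  ... | inj₁ e         = cong (M (suc a)) (sym e)
  ... | inj₂ (e₁ , e₂) = trans (cong (M (suc a)) e₂) (trans (Mp≡Mq (suc a)) (cong (M (suc a)) (sym e₁)))
  termq : laplaceTerm M q ≡ - laplaceTerm M p
  termq = begin
    alt (toℕ q) (M zero q * det (minor M q))
      ≡⟨ cong (λ k → alt k (M zero q * det (minor M q))) (toℕ-adjacent p~q) ⟩
    alt (suc (toℕ p)) (M zero q * det (minor M q))
      ≡⟨ cong₂ (λ x d → alt (suc (toℕ p)) (x * d)) (sym (Mp≡Mq zero)) (det-cong minors) ⟩
    - laplaceTerm M p                              ∎

swapColumns : ∀ {n} → Matrix n n → Fin n → Fin n → Matrix n n
swapColumns M p q = replaceColumn (replaceColumn M p (column M q)) q (column M p)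

module _ {n} {M : Matrix n n} {p q : Fin n} (p≢q : p ≢ q) where

  private
    R : (Fin n → ℤ) → (Fin n → ℤ) → Matrix n n
    R x y = replaceColumn (replaceColumn M p x) q y

    R-p : ∀ x y a → R x y a p ≡ x a
    R-p x y a = trans (replaceColumn-off (replaceColumn M p x) q y a p≢q) (replaceColumn-at M p x a)

    R-+ˡ : ∀ x x′ y → det (R (λ a → x a + x′ a) y) ≡ det (R x y) + det (R x′ y)
    R-+ˡ x x′ y = det-column-+ p
      (replaceColumn-preservesAgree y (replaceColumn-agree M p x x+x′))
      (replaceColumn-preservesAgree y (replaceColumn-agree M p x′ x+x′))
      λ a → trans (R-p x+x′ y a) (sym (cong₂ _+_ (R-p x y a) (R-p x′ y a)))
      where
      x+x′ : Fin n → ℤ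
      x+x′ a = x a + x′ a

    R-+ʳ : ∀ x y y′ → det (R x (λ a → y a + y′ a)) ≡ det (R x y) + det (R x y′)
    R-+ʳ x = det-replaceColumn-+ (replaceColumn M p x) q

    R-self : det (R (column M p) (column M q)) ≡ det M
    R-self = det-cong λ a b →
      trans (updateAt-id-local q _ (sym (replaceColumn-off M p (column M p) a (p≢q ∘ sym))) b)
            (updateAt-id-local p (M a) refl b)

  swapColumns-p : ∀ a → swapColumns M p q a p ≡ M a q
  swapColumns-p = R-p (column M q) (column M p)

  swapColumns-off : ∀ a {b} → b ≢ p → b ≢ q → swapColumns M p q a b ≡ M a b
  swapColumns-off a b≢p b≢q = trans (replaceColumn-off (replaceColumn M p (column M q)) q (column M p) a b≢q)
                                    (replaceColumn-off M p (column M q) a b≢p)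

  -- Expand the vanishing det (R (cₚ + c_q) (cₚ + c_q)) bilinearly.
  det-swapColumns : (∀ {N : Matrix n n} → (∀ a → N a p ≡ N a q) → det N ≡ 0ℤ) →
                    det (swapColumns M p q) ≡ - det M
  det-swapColumns alternating = cancel (det M) (det (R cq cp)) (begin
    0ℤ                                                         ≡⟨ equal s ⟨
    det (R s s)                                                ≡⟨ R-+ˡ cp cq s ⟩
    det (R cp s) + det (R cq s)                                ≡⟨ cong₂ _+_ (R-+ʳ cp cp cq) (R-+ʳ cq cp cq) ⟩
    (det (R cp cp) + det (R cp cq)) + (det (R cq cp) + det (R cq cq))
      ≡⟨ cong₂ (λ x y → (x + det (R cp cq)) + (det (R cq cp) + y)) (equal cp) (equal cq) ⟩
    (0ℤ + det (R cp cq)) + (det (R cq cp) + 0ℤ)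
      ≡⟨ cong (λ d → (0ℤ + d) + (det (R cq cp) + 0ℤ)) R-self ⟩
    (0ℤ + det M) + (det (R cq cp) + 0ℤ)                        ∎)
    where
    cp cq s : Fin n → ℤ
    cp = column M p
    cq = column M q
    s a = cp a + cq a
    equal : ∀ x → det (R x x) ≡ 0ℤ
    equal x = alternating λ a → trans (R-p x x a) (sym (replaceColumn-at (replaceColumn M p x) q x a))
    cancel : ∀ d e → 0ℤ ≡ (0ℤ + d) + (e + 0ℤ) → e ≡ - d
    cancel d e eq = begin
      e                               ≡⟨ rearrange d e ⟩
      ((0ℤ + d) + (e + 0ℤ)) + - d     ≡⟨ cong (_+ - d) eq ⟨
      0ℤ + - d                        ≡⟨ ℤP.+-identityˡ (- d) ⟩
      - d                             ∎
      where
      rearrange : ∀ d e → e ≡ ((0ℤ + d) + (e + 0ℤ)) + - d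
      rearrange = solve-∀

private
  -- Swapping q with its left neighbour negates the determinant and brings the equal columns closer.
  det-equalColumns< : ∀ d {n} {M : Matrix n n} {p q} → toℕ q ≡ d → p F.< q → (∀ a → M a p ≡ M a q) →
                      det M ≡ 0ℤ
  det-equalColumns< zero    {q = zero}  _ ()
  det-equalColumns< (suc d) {q = zero}  ()
  det-equalColumns< (suc d) {suc n} {M} {p} {suc q} toℕq≡ p<q Mp≡Mq with p ≟ inject₁ q
  ... | yes refl = det-adjacentColumns {M = M} (inject₁-adjacent q) Mp≡Mq
  ... | no p≢r   = begin
    det M                    ≡⟨ ℤP.neg-involutive (det M) ⟨
    - - det M
      ≡⟨ cong -_ (det-swapColumns {M = M} r≢q λ {N} → det-adjacentColumns {M = N} (inject₁-adjacent q)) ⟨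
    - det (swapColumns M r (suc q)) ≡⟨ cong -_ swapped≡0 ⟩
    - 0ℤ                     ∎
    where
    r = inject₁ q
    r≢q : r ≢ suc q
    r≢q = adjacent⇒≢ (inject₁-adjacent q)
    p<r : p F.< r
    p<r = ℕP.≤∧≢⇒< (subst (toℕ p ℕ.≤_) (sym (FP.toℕ-inject₁ q)) (ℕP.≤-pred p<q))
                   (p≢r ∘ FP.toℕ-injective)
    swapped≡0 : det (swapColumns M r (suc q)) ≡ 0ℤ
    swapped≡0 = det-equalColumns< d {M = swapColumns M r (suc q)}
                  (trans (FP.toℕ-inject₁ q) (ℕP.suc-injective toℕq≡)) p<r λ a →
      trans (swapColumns-off {M = M} r≢q a p≢r (FP.<⇒≢ p<q)) (trans (Mp≡Mq a) (sym (swapColumns-p {M = M} r≢q a)))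

det-equalColumns : ∀ {n} {M : Matrix n n} {p q} → p ≢ q → (∀ a → M a p ≡ M a q) → det M ≡ 0ℤ
det-equalColumns {p = p} {q} p≢q Mp≡Mq with FP.<-cmp p q
... | tri< p<q _ _ = det-equalColumns< _ refl p<q Mp≡Mq
... | tri≈ _ p≡q _ = contradiction p≡q p≢q
... | tri> _ _ q<p = det-equalColumns< _ refl q<p (sym ∘ Mp≡Mq)

det-addColumnMultiple : ∀ {n} (M : Matrix n n) {j c} x → c ≢ j →
                        det (replaceColumn M j (λ a → M a j + x * M a c)) ≡ det M
det-addColumnMultiple M {j} {c} x c≢j = begin
  det (replaceColumn M j (λ a → M a j + x * M a c))
    ≡⟨ det-replaceColumn-+ M j (column M j) (λ a → x * M a c) ⟩
  det (replaceColumn M j (column M j)) + det (replaceColumn M j (λ a → x * M a c))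
    ≡⟨ cong₂ _+_ (det-replaceColumn-self M j) (det-replaceColumn-* M j x (column M c)) ⟩
  det M + x * det (replaceColumn M j (column M c))
    ≡⟨ cong (λ d → det M + x * d) (det-equalColumns c≢j λ a →
         trans (replaceColumn-off M j (column M c) a c≢j) (sym (replaceColumn-at M j (column M c) a))) ⟩
  det M + x * 0ℤ
    ≡⟨ cong (det M +_) (ℤP.*-zeroʳ x) ⟩
  det M + 0ℤ
    ≡⟨ ℤP.+-identityʳ (det M) ⟩
  det M ∎

addColumnMultiples : ∀ {n} → Matrix n n → Fin n → (Fin n → ℤ) → Matrix n n
addColumnMultiples M c t a b = M a b + t b * M a c

det-addColumnMultiples : ∀ {n} (M : Matrix n n) c (t : Fin n → ℤ) → t c ≡ 0ℤ →
                         det (addColumnMultiples M c t) ≡ det M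
det-addColumnMultiples {n} M c t tc = supported (allFin n) t tc λ b b∉ → contradiction (∈-allFin b) b∉
  where
  -- Induction on a list of columns outside of which t vanishes, clearing one entry of t at a time.
  supported : ∀ bs t → t c ≡ 0ℤ → (∀ b → b ∉ bs → t b ≡ 0ℤ) → det (addColumnMultiples M c t) ≡ det M
  supported []       t _  t≡0 = det-cong λ a b →
    trans (cong (λ y → M a b + y * M a c) (t≡0 b λ ())) (ℤP.+-identityʳ (M a b))
  supported (j ∷ bs) t tc t≡0 = trans peel (supported bs t′ t′c t′≡0)
    where
    t′ : Fin n → ℤ
    t′ = updateAt t j (const 0ℤ)
    t′-off : ∀ {b} → b ≢ j → t′ b ≡ t b
    t′-off {b} = updateAt-minimal b j t
    t′c : t′ c ≡ 0ℤ
    t′c with c ≟ j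
    ... | yes refl = updateAt-updates j t
    ... | no c≢j   = trans (t′-off c≢j) tc
    t′≡0 : ∀ b → b ∉ bs → t′ b ≡ 0ℤ
    t′≡0 b b∉ with b ≟ j
    ... | yes refl = updateAt-updates j t
    ... | no b≢j   = trans (t′-off b≢j) (t≡0 b λ { (here b≡j) → b≢j b≡j ; (there b∈) → b∉ b∈ })
    peel : det (addColumnMultiples M c t) ≡ det (addColumnMultiples M c t′)
    peel with c ≟ j
    ... | yes refl = det-cong λ a b → cong (λ y → M a b + y * M a c) (sym (updateAt-id-local c t (sym tc) b))
    ... | no c≢j   = trans (det-cong columns) (det-addColumnMultiple N′ (t j) c≢j)
      where
      N′ : Matrix n n
      N′ = addColumnMultiples M c t′
      w : Fin n → ℤ
      w a = N′ a j + t j * N′ a c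
      columns : ∀ a b → addColumnMultiples M c t a b ≡ replaceColumn N′ j w a b
      columns a b with b ≟ j
      ... | yes refl = trans (reassociate (M a b) (t b) (M a c))
        (trans (cong₂ (λ y z → (M a b + y * M a c) + t b * (M a c + z * M a c))
                      (sym (updateAt-updates b {const 0ℤ} t)) (sym t′c))
               (sym (replaceColumn-at N′ b w a)))
        where
        reassociate : ∀ x y z → x + y * z ≡ (x + 0ℤ * z) + y * (z + 0ℤ * z)
        reassociate = solve-∀
      ... | no b≢j   = trans (cong (λ y → M a b + y * M a c) (sym (t′-off b≢j)))
                             (sym (replaceColumn-off N′ j w a b≢j))

replaceRow₀ : ∀ {m n} → (Fin n → ℤ) → Matrix (suc m) n → Matrix (suc m) n
replaceRow₀ r M = updateAt M zero (const r)

det-row₀-+ : ∀ {n} (M : Matrix (suc n) (suc n)) u v → (∀ b → M zero b ≡ u b + v b) →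
             det M ≡ det (replaceRow₀ u M) + det (replaceRow₀ v M)
det-row₀-+ M u v M₀≡u+v = begin
  det M                                         ≡⟨ det-laplace M ⟩
  sum (laplaceTerm M)                           ≡⟨ sum-cong-≗ term ⟩
  sum (λ j → laplaceTerm U j + laplaceTerm V j) ≡⟨ ∑-distrib-+ (laplaceTerm U) (laplaceTerm V) ⟩
  sum (laplaceTerm U) + sum (laplaceTerm V)     ≡⟨ cong₂ _+_ (det-laplace U) (det-laplace V) ⟨
  det U + det V                                 ∎
  where
  U = replaceRow₀ u M
  V = replaceRow₀ v M
  term : ∀ j → laplaceTerm M j ≡ laplaceTerm U j + laplaceTerm V j
  term j = begin
    alt k (M zero j * d)           ≡⟨ cong (λ x → alt k (x * d)) (M₀≡u+v j) ⟩
    alt k ((u j + v j) * d)        ≡⟨ cong (alt k) (ℤP.*-distribʳ-+ d (u j) (v j)) ⟩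
    alt k (u j * d + v j * d)      ≡⟨ alt-+ k (u j * d) (v j * d) ⟩
    alt k (u j * d) + alt k (v j * d) ∎
    where
    k = toℕ j
    d = det (minor M j)

det-row₀-neg : ∀ {n} (M : Matrix (suc n) (suc n)) u →
               det (replaceRow₀ (λ b → - u b) M) ≡ - det (replaceRow₀ u M)
det-row₀-neg M u = begin
  det (replaceRow₀ (λ b → - u b) M)           ≡⟨ det-laplace (replaceRow₀ (λ b → - u b) M) ⟩
  sum (laplaceTerm (replaceRow₀ (λ b → - u b) M)) ≡⟨ sum-cong-≗ term ⟩
  sum (λ j → -1ℤ * laplaceTerm U j)           ≡⟨ *-distribˡ-sum -1ℤ (laplaceTerm U) ⟨
  -1ℤ * sum (laplaceTerm U)                   ≡⟨ ℤP.-1*i≡-i _ ⟩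
  - sum (laplaceTerm U)                       ≡⟨ cong -_ (det-laplace U) ⟨
  - det U                                     ∎
  where
  U = replaceRow₀ u M
  term : ∀ j → alt (toℕ j) (- u j * det (minor M j)) ≡ -1ℤ * laplaceTerm U j
  term j = begin
    alt k (- u j * d)        ≡⟨ cong (alt k) (ℤP.neg-distribˡ-* (u j) d) ⟨
    alt k (- (u j * d))      ≡⟨ cong (alt k) (ℤP.-1*i≡-i (u j * d)) ⟨
    alt k (-1ℤ * (u j * d))  ≡⟨ alt-* k -1ℤ (u j * d) ⟩
    -1ℤ * alt k (u j * d)    ∎
    where
    k = toℕ j
    d = det (minor M j)

laplaceTerm≡0 : ∀ {n} (M : Matrix (suc n) (suc n)) {j} → M zero j ≡ 0ℤ → laplaceTerm M j ≡ 0ℤ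
laplaceTerm≡0 M {j} M₀ⱼ≡0 = trans (cong (λ x → alt (toℕ j) (x * det (minor M j))) M₀ⱼ≡0) (alt-0 (toℕ j))

det-row₀≡0 : ∀ {n} (M : Matrix (suc n) (suc n)) → (∀ j → M zero j ≡ 0ℤ) → det M ≡ 0ℤ
det-row₀≡0 M row₀≡0 = trans (det-laplace M) (sum-zero λ j → laplaceTerm≡0 M (row₀≡0 j))

det-row₀-single : ∀ {n} (M : Matrix (suc n) (suc n)) c → (∀ j → j ≢ c → M zero j ≡ 0ℤ) →
                  det M ≡ laplaceTerm M c
det-row₀-single M c row₀≡0 = trans (det-laplace M) (sum-single c λ j j≢c → laplaceTerm≡0 M (row₀≡0 j j≢c))

-- Network matrices

indicator : ∀ {k} → Maybe (Fin k) → Fin k → ℤ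
indicator nothing  _ = 0ℤ
indicator (just i) a = unit i a

-- A column of the incidence matrix of a directed graph, e_head − e_tail, where a missing
-- endpoint contributes nothing.
record Network {k} (v : Fin k → ℤ) : Set where
  constructor network
  field
    head tail : Maybe (Fin k)
    incidence : ∀ a → v a ≡ indicator head a - indicator tail a

indicator-01 : ∀ {k} (h : Maybe (Fin k)) a → indicator h a ≡ 0ℤ ⊎ indicator h a ≡ 1ℤ
indicator-01 nothing  a = inj₁ refl
indicator-01 (just i) a with a ≟ i
... | yes _ = inj₂ refl
... | no  _ = inj₁ refl

indicator≡1 : ∀ {k} (h : Maybe (Fin k)) {a} → indicator h a ≡ 1ℤ → h ≡ just a
indicator≡1 nothing  ()
indicator≡1 (just i) {a} e with a ≟ i
... | yes refl = refl
indicator≡1 (just i) () | no _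

Network-cong : ∀ {k} {v w : Fin k → ℤ} → (∀ a → v a ≡ w a) → Network v → Network w
Network-cong v≗w (network h t v≡) = network h t λ a → trans (sym (v≗w a)) (v≡ a)

module _ {k} {v : Fin k → ℤ} (N : Network v) (a : Fin k) where
  open Network N

  Network-entry : v a ≡ 0ℤ ⊎ v a ≡ 1ℤ ⊎ v a ≡ -1ℤ
  Network-entry rewrite incidence a with indicator-01 head a | indicator-01 tail a
  ... | inj₁ h≡0 | inj₁ t≡0 rewrite h≡0 | t≡0 = inj₁ refl
  ... | inj₁ h≡0 | inj₂ t≡1 rewrite h≡0 | t≡1 = inj₂ (inj₂ refl)
  ... | inj₂ h≡1 | inj₁ t≡0 rewrite h≡1 | t≡0 = inj₂ (inj₁ refl)
  ... | inj₂ h≡1 | inj₂ t≡1 rewrite h≡1 | t≡1 = inj₁ refl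

  Network-nonzeroEntry : v a ≢ 0ℤ → v a ≡ 1ℤ ⊎ v a ≡ -1ℤ
  Network-nonzeroEntry va≢0 with Network-entry
  ... | inj₁ va≡0 = contradiction va≡0 va≢0
  ... | inj₂ va≡±1 = va≡±1

  Network-head : v a ≡ 1ℤ → head ≡ just a
  Network-head va≡1 with indicator-01 head a | indicator-01 tail a
  ... | inj₂ h≡1 | _ = indicator≡1 head h≡1
  ... | inj₁ h≡0 | inj₁ t≡0 with () ← trans (sym va≡1) (trans (incidence a) (cong₂ _-_ h≡0 t≡0))
  ... | inj₁ h≡0 | inj₂ t≡1 with () ← trans (sym va≡1) (trans (incidence a) (cong₂ _-_ h≡0 t≡1))

  Network-tail : v a ≡ -1ℤ → tail ≡ just a
  Network-tail va≡-1 with indicator-01 head a | indicator-01 tail a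
  ... | _ | inj₂ t≡1 = indicator≡1 tail t≡1
  ... | inj₁ h≡0 | inj₁ t≡0 with () ← trans (sym va≡-1) (trans (incidence a) (cong₂ _-_ h≡0 t≡0))
  ... | inj₂ h≡1 | inj₁ t≡0 with () ← trans (sym va≡-1) (trans (incidence a) (cong₂ _-_ h≡1 t≡0))

Network-neg : ∀ {k} {v : Fin k → ℤ} → Network v → Network (λ a → - v a)
Network-neg (network h t v≡) = network t h λ a → trans (cong -_ (v≡ a)) (negate-difference (indicator h a) (indicator t a))
  where
  negate-difference : ∀ x y → - (x - y) ≡ y - x
  negate-difference = solve-∀

-- Two network columns with a common nonzero entry share the corresponding endpoint, which cancels.
Network-sub : ∀ {k} {v w : Fin k → ℤ} → Network v → Network w → ∀ {a} → v a ≡ w a → v a ≢ 0ℤ →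
              Network (λ b → v b - w b)
Network-sub {v = v} {w} Nv@(network h₁ t₁ v≡) Nw@(network h₂ t₂ w≡) {a} va≡wa va≢0
  with Network-nonzeroEntry Nv a va≢0
... | inj₁ va≡1 = network t₂ t₁ λ b → begin
  v b - w b                                                 ≡⟨ cong₂ _-_ (v≡ b) (w≡ b) ⟩
  (indicator h₁ b - indicator t₁ b) - (indicator h₂ b - indicator t₂ b)
    ≡⟨ cong (λ x → (x - indicator t₁ b) - (indicator h₂ b - indicator t₂ b)) (same-head b) ⟩
  (indicator h₂ b - indicator t₁ b) - (indicator h₂ b - indicator t₂ b)
    ≡⟨ cancel-head (indicator h₂ b) (indicator t₁ b) (indicator t₂ b) ⟩
  indicator t₂ b - indicator t₁ b                           ∎
  where
  same-head : ∀ b → indicator h₁ b ≡ indicator h₂ b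
  same-head b = cong (λ h → indicator h b)
    (trans (Network-head Nv a va≡1) (sym (Network-head Nw a (trans (sym va≡wa) va≡1))))
  cancel-head : ∀ x y z → (x - y) - (x - z) ≡ z - y
  cancel-head = solve-∀
... | inj₂ va≡-1 = network h₁ h₂ λ b → begin
  v b - w b                                                 ≡⟨ cong₂ _-_ (v≡ b) (w≡ b) ⟩
  (indicator h₁ b - indicator t₁ b) - (indicator h₂ b - indicator t₂ b)
    ≡⟨ cong (λ x → (indicator h₁ b - x) - (indicator h₂ b - indicator t₂ b)) (same-tail b) ⟩
  (indicator h₁ b - indicator t₂ b) - (indicator h₂ b - indicator t₂ b)
    ≡⟨ cancel-tail (indicator h₁ b) (indicator t₂ b) (indicator h₂ b) ⟩
  indicator h₁ b - indicator h₂ b                           ∎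
  where
  same-tail : ∀ b → indicator t₁ b ≡ indicator t₂ b
  same-tail b = cong (λ t → indicator t b)
    (trans (Network-tail Nv a va≡-1) (sym (Network-tail Nw a (trans (sym va≡wa) va≡-1))))
  cancel-tail : ∀ x y z → (x - y) - (z - y) ≡ x - z
  cancel-tail = solve-∀

indicator-reindex : ∀ {k l} (f : Fin l → Fin k) → Injective _≡_ _≡_ f → ∀ h →
                    Σ[ h′ ∈ Maybe (Fin l) ] (∀ a → indicator h (f a) ≡ indicator h′ a)
indicator-reindex f f-inj nothing = nothing , λ _ → refl
indicator-reindex f f-inj (just i) with FP.any? (λ a → f a ≟ i)
... | yes (a₀ , fa₀≡i) = just a₀ , λ a → preimage a
  where
  preimage : ∀ a → unit i (f a) ≡ unit a₀ a
  preimage a with f a ≟ i | a ≟ a₀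
  ... | yes _    | yes _    = refl
  ... | yes fa≡i | no a≢a₀  = contradiction (f-inj (trans fa≡i (sym fa₀≡i))) a≢a₀
  ... | no fa≢i  | yes refl = contradiction fa₀≡i fa≢i
  ... | no _     | no _     = refl
... | no ∄a = nothing , λ a → missed a
  where
  missed : ∀ a → unit i (f a) ≡ 0ℤ
  missed a with f a ≟ i
  ... | yes fa≡i = contradiction (a , fa≡i) ∄a
  ... | no _     = refl

Network-reindex : ∀ {k l} {v : Fin k → ℤ} (f : Fin l → Fin k) → Injective _≡_ _≡_ f →
                  Network v → Network (v ∘ f)
Network-reindex f f-inj (network h t v≡)
  with indicator-reindex f f-inj h | indicator-reindex f f-inj t
... | h′ , h≗ | t′ , t≗ = network h′ t′ λ a → trans (v≡ (f a)) (cong₂ _-_ (h≗ a) (t≗ a))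

pivot-cancels : ∀ x s → s ≡ 1ℤ ⊎ s ≡ -1ℤ → x + - (x * s) * s ≡ 0ℤ
pivot-cancels x s s≡±1 = begin
  x + - (x * s) * s    ≡⟨ reassociate x s ⟩
  x + - (x * (s * s))  ≡⟨ cong (λ y → x + - (x * y)) (square≡1 s≡±1) ⟩
  x + - (x * 1ℤ)       ≡⟨ cong (λ y → x + - y) (ℤP.*-identityʳ x) ⟩
  x + - x              ≡⟨ ℤP.+-inverseʳ x ⟩
  0ℤ                   ∎
  where
  reassociate : ∀ x s → x + - (x * s) * s ≡ x + - (x * (s * s))
  reassociate = solve-∀
  square≡1 : ∀ {s} → s ≡ 1ℤ ⊎ s ≡ -1ℤ → s * s ≡ 1ℤ
  square≡1 (inj₁ refl) = refl
  square≡1 (inj₂ refl) = refl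

private
  coefficient-cases : ∀ {x s} → x ≡ 0ℤ ⊎ x ≡ 1ℤ ⊎ x ≡ -1ℤ → s ≡ 1ℤ ⊎ s ≡ -1ℤ →
                      (- (x * s) ≡ 0ℤ) ⊎ (x ≡ s × - (x * s) ≡ -1ℤ) ⊎ (x ≡ - s × - (x * s) ≡ 1ℤ)
  coefficient-cases (inj₁ refl)        (inj₁ refl) = inj₁ refl
  coefficient-cases (inj₁ refl)        (inj₂ refl) = inj₁ refl
  coefficient-cases (inj₂ (inj₁ refl)) (inj₁ refl) = inj₂ (inj₁ (refl , refl))
  coefficient-cases (inj₂ (inj₁ refl)) (inj₂ refl) = inj₂ (inj₂ (refl , refl))
  coefficient-cases (inj₂ (inj₂ refl)) (inj₁ refl) = inj₂ (inj₂ (refl , refl))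
  coefficient-cases (inj₂ (inj₂ refl)) (inj₂ refl) = inj₂ (inj₁ (refl , refl))

-- Clearing the entry of v in the pivot row leaves v, v − w or v + w.
Network-eliminate : ∀ {k} {v w : Fin k → ℤ} → Network v → Network w → ∀ {p} → w p ≢ 0ℤ →
                    Network (λ a → v a + - (v p * w p) * w a)
Network-eliminate {v = v} {w} Nv Nw {p} wp≢0
  with coefficient-cases (Network-entry Nv p) (Network-nonzeroEntry Nw p wp≢0)
... | inj₁ c≡0 = Network-cong (λ a → sym (begin
  v a + - (v p * w p) * w a ≡⟨ cong (λ c → v a + c * w a) c≡0 ⟩
  v a + 0ℤ                 ≡⟨ ℤP.+-identityʳ (v a) ⟩
  v a                      ∎)) Nv
... | inj₂ (inj₁ (vp≡wp , c≡-1)) = Network-cong (λ a → sym (begin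
  v a + - (v p * w p) * w a ≡⟨ cong (λ c → v a + c * w a) c≡-1 ⟩
  v a + -1ℤ * w a          ≡⟨ cong (v a +_) (ℤP.-1*i≡-i (w a)) ⟩
  v a - w a                ∎)) (Network-sub Nv Nw vp≡wp λ vp≡0 → wp≢0 (trans (sym vp≡wp) vp≡0))
... | inj₂ (inj₂ (vp≡-wp , c≡1)) = Network-cong (λ a → sym (begin
  v a + - (v p * w p) * w a ≡⟨ cong (λ c → v a + c * w a) c≡1 ⟩
  v a + 1ℤ * w a           ≡⟨ cong (v a +_) (ℤP.*-identityˡ (w a)) ⟩
  v a + w a                ≡⟨ cong (v a +_) (ℤP.neg-involutive (w a)) ⟨
  v a - - w a              ∎)) (Network-sub Nv (Network-neg Nw) vp≡-wp λ vp≡0 →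
    wp≢0 (trans (sym (ℤP.neg-involutive (w p))) (cong -_ (trans (sym vp≡-wp) vp≡0))))

∣±1*i∣ : ∀ {s} i → s ≡ 1ℤ ⊎ s ≡ -1ℤ → ∣ s * i ∣ ≡ ∣ i ∣
∣±1*i∣ i (inj₁ refl) = cong ∣_∣ (ℤP.*-identityˡ i)
∣±1*i∣ i (inj₂ refl) = trans (cong ∣_∣ (ℤP.-1*i≡-i i)) (ℤP.∣-i∣≡∣i∣ i)

network⇒∣det∣≤1 : ∀ {n} (M : Matrix n n) → (∀ j → Network (column M j)) → ∣ det M ∣ ℕ.≤ 1
network⇒∣det∣≤1 {zero}  M _   = ℕP.≤-refl
network⇒∣det∣≤1 {suc n} M net with FP.any? (λ c → ¬? (M zero c ℤ.≟ 0ℤ))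
... | no ∄c = ℕP.≤-trans (ℕP.≤-reflexive (cong ∣_∣ (det-row₀≡0 M row₀≡0))) z≤n
  where
  row₀≡0 : ∀ j → M zero j ≡ 0ℤ
  row₀≡0 j = decidable-stable (M zero j ℤ.≟ 0ℤ) λ M₀ⱼ≢0 → ∄c (j , M₀ⱼ≢0)
... | yes (c , σ≢0) = subst (ℕ._≤ 1) (sym ∣det∣≡∣minor∣) (network⇒∣det∣≤1 (minor N c) minor-network)
  where
  σ : ℤ
  σ = M zero c
  multiplier : Fin (suc n) → ℤ
  multiplier b = - (M zero b * σ)
  t : Fin (suc n) → ℤ
  t = updateAt multiplier c (const 0ℤ)
  N : Matrix (suc n) (suc n)
  N = addColumnMultiples M c t
  N-row₀ : ∀ j → j ≢ c → N zero j ≡ 0ℤ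
  N-row₀ j j≢c = trans (cong (λ y → M zero j + y * σ) (updateAt-minimal j c multiplier j≢c))
                       (pivot-cancels (M zero j) σ (Network-nonzeroEntry (net c) zero σ≢0))
  N-pivot : N zero c ≡ σ
  N-pivot = trans (cong (λ y → σ + y * σ) (updateAt-updates c multiplier)) (ℤP.+-identityʳ σ)
  N-network : ∀ j → j ≢ c → Network (column N j)
  N-network j j≢c = Network-cong (λ a → cong (λ y → M a j + y * M a c) (sym (updateAt-minimal j c multiplier j≢c)))
                                 (Network-eliminate (net j) (net c) σ≢0)
  minor-network : ∀ b → Network (column (minor N c) b)
  minor-network b = Network-reindex suc FP.suc-injective (N-network (punchIn c b) (FP.punchInᵢ≢i c b))
  ∣det∣≡∣minor∣ : ∣ det M ∣ ≡ ∣ det (minor N c) ∣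
  ∣det∣≡∣minor∣ = begin
    ∣ det M ∣
      ≡⟨ cong ∣_∣ (det-addColumnMultiples M c t (updateAt-updates c multiplier)) ⟨
    ∣ det N ∣                                     ≡⟨ cong ∣_∣ (det-row₀-single N c N-row₀) ⟩
    ∣ alt (toℕ c) (N zero c * det (minor N c)) ∣  ≡⟨ ∣alt∣ (toℕ c) _ ⟩
    ∣ N zero c * det (minor N c) ∣                ≡⟨ cong (λ s → ∣ s * det (minor N c) ∣) N-pivot ⟩
    ∣ σ * det (minor N c) ∣                       ≡⟨ ∣±1*i∣ _ (Network-nonzeroEntry (net c) zero σ≢0) ⟩
    ∣ det (minor N c) ∣                           ∎

NearNetwork : ∀ {k} → (Fin (suc k) → ℤ) → Set
NearNetwork v = Network v ⊎ Network (updateAt v zero (λ x → - x))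

private
  dropZero : ∀ {k} → Maybe (Fin (suc k)) → Maybe (Fin (suc k))
  dropZero (just zero) = nothing
  dropZero h           = h

  indicator-dropZero : ∀ {k} (h : Maybe (Fin (suc k))) a →
                       indicator (dropZero h) a ≡ updateAt (indicator h) zero (const 0ℤ) a
  indicator-dropZero nothing        zero    = refl
  indicator-dropZero nothing        (suc a) = refl
  indicator-dropZero (just zero)    zero    = refl
  indicator-dropZero (just zero)    (suc a) = refl
  indicator-dropZero (just (suc i)) zero    = refl
  indicator-dropZero (just (suc i)) (suc a) = refl

Network-clearTop : ∀ {k} {v : Fin (suc k) → ℤ} → Network v → Network (updateAt v zero (const 0ℤ))
Network-clearTop (network h t v≡) = network (dropZero h) (dropZero t) λ where
  zero    → sym (cong₂ _-_ (indicator-dropZero h zero) (indicator-dropZero t zero))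
  (suc a) → trans (v≡ (suc a)) (sym (cong₂ _-_ (indicator-dropZero h (suc a)) (indicator-dropZero t (suc a))))

record TopSplit {k} (v : Fin (suc k) → ℤ) : Set where
  field
    top₁ top₂  : ℤ
    top≡       : v zero ≡ top₁ - top₂
    network₁   : Network (updateAt v zero (const top₁))
    network₂   : Network (updateAt v zero (const top₂))

NearNetwork-split : ∀ {k} {v : Fin (suc k) → ℤ} → NearNetwork v → TopSplit v
NearNetwork-split {v = v} (inj₁ N) = record
  { top₁ = v zero ; top₂ = 0ℤ
  ; top≡ = sym (ℤP.+-identityʳ (v zero))
  ; network₁ = Network-cong (λ a → sym (updateAt-id-local zero v refl a)) N
  ; network₂ = Network-clearTop N
  }
NearNetwork-split {v = v} (inj₂ N) = record
  { top₁ = 0ℤ ; top₂ = - v zero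
  ; top≡ = sym (trans (ℤP.+-identityˡ (- - v zero)) (ℤP.neg-involutive (v zero)))
  ; network₁ = Network-cong (λ { zero → refl ; (suc a) → refl }) (Network-clearTop N)
  ; network₂ = Network-cong (λ { zero → refl ; (suc a) → refl }) N
  }

nearNetwork⇒∣det∣≤2 : ∀ {n} (M : Matrix (suc n) (suc n)) → (∀ j → NearNetwork (column M j)) →
                      ∣ det M ∣ ℕ.≤ 2
nearNetwork⇒∣det∣≤2 M near = subst (ℕ._≤ 2) (sym (cong ∣_∣ det-split))
  (ℕP.≤-trans (ℤP.∣i-j∣≤∣i∣+∣j∣ (det P) (det Q))
              (ℕP.+-mono-≤ (network⇒∣det∣≤1 P λ j → Network-cong top-only (network₁ (split j)))
                           (network⇒∣det∣≤1 Q λ j → Network-cong top-only (network₂ (split j)))))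
  where
  open TopSplit
  split : ∀ j → TopSplit (column M j)
  split j = NearNetwork-split (near j)
  P Q : Matrix _ _
  P = replaceRow₀ (λ j → top₁ (split j)) M
  Q = replaceRow₀ (λ j → top₂ (split j)) M
  det-split : det M ≡ det P - det Q
  det-split = trans (det-row₀-+ M (λ j → top₁ (split j)) (λ j → - top₂ (split j)) (λ j → top≡ (split j)))
                    (cong (det P +_) (det-row₀-neg M (λ j → top₂ (split j))))
  top-only : ∀ {u : Fin _ → ℤ} {j} a → updateAt (column M j) zero (const (u j)) a ≡ column (replaceRow₀ u M) j a
  top-only zero    = refl
  top-only (suc a) = refl

-- The matrix A_r

NearNetwork-reindex : ∀ {k l} {v : Fin (suc k) → ℤ} (f : Fin (suc l) → Fin (suc k)) → Injective _≡_ _≡_ f →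
                      (∀ a → f (suc a) ≢ zero) → NearNetwork v → NearNetwork (v ∘ f)
NearNetwork-reindex f f-inj _ (inj₁ N) = inj₁ (Network-reindex f f-inj N)
NearNetwork-reindex {v = v} f f-inj f↑≢0 (inj₂ N) with f zero ≟ zero
... | yes f₀≡0 = inj₂ (Network-cong negated (Network-reindex f f-inj N))
  where
  negated : ∀ a → updateAt v zero (λ x → - x) (f a) ≡ updateAt (v ∘ f) zero (λ x → - x) a
  negated zero    rewrite f₀≡0 = refl
  negated (suc a) = updateAt-minimal (f (suc a)) zero v (f↑≢0 a)
... | no f₀≢0 = inj₁ (Network-cong (λ a → updateAt-minimal (f a) zero v (f≢0 a)) (Network-reindex f f-inj N))
  where
  f≢0 : ∀ a → f a ≢ zero
  f≢0 zero    = f₀≢0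
  f≢0 (suc a) = f↑≢0 a

Increasing⇒injective : ∀ {k n} {f : Fin k → Fin n} → Increasing f → Injective _≡_ _≡_ f
Increasing⇒injective {f = f} f↑ {a} {b} fa≡fb with FP.<-cmp a b
... | tri< a<b _ _ = contradiction fa≡fb (FP.<⇒≢ (f↑ a b a<b))
... | tri≈ _ a≡b _ = a≡b
... | tri> _ _ b<a = contradiction (sym fa≡fb) (FP.<⇒≢ (f↑ b a b<a))

Increasing⇒suc≢zero : ∀ {k n} {f : Fin (suc k) → Fin (suc n)} → Increasing f → ∀ a → f (suc a) ≢ zero
Increasing⇒suc≢zero {f = f} f↑ a f₁₊ₐ≡0 with () ← subst (f zero F.<_) f₁₊ₐ≡0 (f↑ zero (suc a) (s≤s z≤n))

unit-network : ∀ {k} (i : Fin k) → Network (unit i)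
unit-network i = network (just i) nothing λ a → sym (ℤP.+-identityʳ (unit i a))

difference-network : ∀ {k} (i j : Fin k) → Network (λ a → unit i a + - unit j a)
difference-network i j = network (just i) (just j) λ _ → refl

B-nearNetwork : ∀ {k} (j : Fin (suc k)) → 1 ℕ.≤ toℕ j →
                NearNetwork (λ a → (if does (toℕ a ℕ.≟ 0) then 1ℤ else 0ℤ) + unit j a)
B-nearNetwork (suc j) _ = inj₂ (network (just (suc j)) (just zero) λ where
  zero    → refl
  (suc a) → trans (ℤP.+-identityˡ (unit (suc j) (suc a))) (sym (ℤP.+-identityʳ (unit (suc j) (suc a)))))

colsA-nearNetwork : ∀ r → All NearNetwork (colsA (suc r))
colsA-nearNetwork r = ++⁺ colsI-near (++⁺ colsD-near colsB-near)
  where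
  colsI-near : All NearNetwork (colsI (suc r))
  colsI-near = map⁺ {xs = allFin (suc r)} (All.tabulate λ {i} _ → inj₁ (unit-network i))
  colsD-near : All NearNetwork (colsD (suc r))
  colsD-near = concat⁺ (map⁺ {xs = allFin (suc r)} (All.tabulate λ {i} _ →
    map⁺ (filter⁺ (λ j → toℕ i ℕ.<? toℕ j)
                  (All.tabulate {xs = allFin (suc r)} λ {j} _ → inj₁ (difference-network i j)))))
  colsB-near : All NearNetwork (colsB (suc r))
  colsB-near = map⁺ (All.map (λ {j} → B-nearNetwork j) (all-filter (λ j → 1 ℕ.≤? toℕ j) (allFin (suc r))))

A-nearNetwork : ∀ r j → NearNetwork (column (A (suc r)) j)
A-nearNetwork r j = All.lookup (colsA-nearNetwork r) (∈-lookup j)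

∣det-submatrix-A∣≤2 : ∀ r {k} (rs : Fin k → Fin r) (cs : Fin k → Fin (length (colsA r))) →
                      Increasing rs → Increasing cs → ∣ det (submatrix (A r) rs cs) ∣ ℕ.≤ 2
∣det-submatrix-A∣≤2 r       {zero}  _  _  _   _ = s≤s z≤n
∣det-submatrix-A∣≤2 zero    {suc k} rs _  _   _ with () ← rs zero
∣det-submatrix-A∣≤2 (suc r) {suc k} rs cs rs↑ _ = nearNetwork⇒∣det∣≤2 _ λ j →
  NearNetwork-reindex rs (Increasing⇒injective rs↑) (Increasing⇒suc≢zero rs↑) (A-nearNetwork r (cs j))

-- Every square minor is bounded.
lemma3p1 : ∀ (r : ℕ) → 2 ≤ r → IsModular 2 (A r)
lemma3p1 r _ _ _ rs cs rs↑ cs↑ = ∣det-submatrix-A∣≤2 r rs cs rs↑ cs↑
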